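{- A finite set $S$ of PLTL-clauses is unsatisfiable if and only if its reduced behaviour graph is empty.
   Context: Models are infinite sequences $\sigma=s_0,s_1,\dots$ of sets of proposition symbols; $(\sigma,i)\models p$ iff $p\in s_i$; $\bigcirc A$ (next) at $i$ iff $A$ at $i+1$; $\Diamond A$ (sometime) at $i$ iff $A$ at some $k\ge i$; $\Box A$ (always) at $i$ iff $A$ at all $j\ge i$; Boolean connectives as usual; $\mathbf{start}$ holds exactly at index $0$. A literal is a proposition symbol or its negation. A PLTL-clause has one of the forms $\mathbf{start}\Rightarrow\bigvee_c l_c$ (initial clause), $\bigwedge_a k_a\Rightarrow\bigcirc\bigvee_d l_d$ (step clause), $\bigwedge_b k_b\Rightarrow\Diamond l$ (sometime clause), all $k,l$ literals. A set $\{A_i\}$ of clauses is satisfiable iff $(\sigma,0)\models\Box\bigwedge_iA_i$ for some model $\sigma$. The literals $l$ on the right of sometime clauses are the eventuality literals. Behaviour graph of $S$: consider the directed graph whose nodes are all pairs $(V,E)$ with $V$ a valuation of the proposition symbols occurring in $S$ and $E$ a subset of the eventuality literals of $S$. For a node $(V,E)$, let $L$ be the set of right-hand sides (with $\bigcirc$ removed) of step clauses of $S$ whose left-hand sides are satisfied by $V$, and $E'$ the elements of $E$ not satisfied by $V$; for each valuation $V'$ satisfying all of $L$, with $E''$ the set of eventuality literals $l$ of sometime clauses $C\Rightarrow\Diamond l$ in $S$ whose $C$ is satisfied by $V'$, there is an edge $(V,E)\to(V',E'\cup E'')$, and no others leave $(V,E)$. A node $(V,E')$ is initial if $V$ satisfies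 the right-hand sides of all initial clauses of $S$ and $E'$ is the set of eventuality literals of sometime clauses whose left-hand sides $V$ satisfies. The behaviour graph is the subgraph induced by nodes reachable from initial nodes, with its initial nodes designated. Reduced behaviour graph: starting from the behaviour graph, apply the following deletions repeatedly until none is possible: (i) delete any node with no successors (and all edges into it); (ii) delete any node $n=(V,E)$ such that some $l\in E$ is not satisfied by $V$ and there is no path from $n$ to a node whose valuation satisfies $l$. -}

module Defs where

open import Data.Nat using (ℕ; zero; suc; _≤_; _≡ᵇ_)
open import Data.Bool using (Bool; true; false; not; _∧_; _∨_; if_then_else_; T)
open import Data.List using (List; []; _∷_; map; concatMap; foldr; deduplicateᵇ; length)
open import Data.Bool.ListAction using (any; all)
open import Data.Vec using (Vec; []; _∷_; lookup; zipWith; fromList)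
open import Data.Fin using (Fin)
open import Data.Product using (Σ; _×_; _,_; proj₁; proj₂)
open import Data.Sum using (_⊎_)
open import Data.Empty using (⊥)
open import Data.Unit using (⊤)
open import Relation.Nullary using (¬_)
open import Relation.Binary.PropositionalEquality using (_≡_; _≢_)
open import Relation.Binary.Construct.Closure.ReflexiveTransitive using (Star)

Sym : Set
Sym = ℕ

data Literal : Set where
  pos : Sym → Literal
  neg : Sym → Literal

data Clause : Set where
  initial  : List Literal → Clause
  step     : List Literal → List Literal → Clause
  sometime : List Literal → Literal → Clause

data Formula : Set where
  atom  : Sym → Formula
  start : Formula
  tt ff : Formula
  ¬'    : Formula → Formula
  _∧'_ _∨'_ _⇒'_ : Formula → Formula → Formula
  ○ ◇ □ : Formula → Formula

-- Semantics: a model is an infinite sequence of sets of symbols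
-- (represented by characteristic functions)

Model : Set
Model = ℕ → Sym → Bool

_,_⊨_ : Model → ℕ → Formula → Set
σ , i ⊨ atom p  = T (σ i p)
σ , i ⊨ start   = i ≡ 0
σ , i ⊨ tt      = ⊤
σ , i ⊨ ff      = ⊥
σ , i ⊨ ¬' A    = ¬ (σ , i ⊨ A)
σ , i ⊨ (A ∧' B) = (σ , i ⊨ A) × (σ , i ⊨ B)
σ , i ⊨ (A ∨' B) = (σ , i ⊨ A) ⊎ (σ , i ⊨ B)
σ , i ⊨ (A ⇒' B) = (σ , i ⊨ A) → (σ , i ⊨ B)
σ , i ⊨ ○ A     = σ , suc i ⊨ A
σ , i ⊨ ◇ A     = Σ ℕ λ k → i ≤ k × (σ , k ⊨ A)
σ , i ⊨ □ A     = ∀ j → i ≤ j → σ , j ⊨ A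

litF : Literal → Formula
litF (pos p) = atom p
litF (neg p) = ¬' (atom p)

⋀ : List Formula → Formula
⋀ = foldr _∧'_ tt

⋁ : List Formula → Formula
⋁ = foldr _∨'_ ff

clauseF : Clause → Formula
clauseF (initial ls)    = start ⇒' ⋁ (map litF ls)
clauseF (step ks ls)    = ⋀ (map litF ks) ⇒' ○ (⋁ (map litF ls))
clauseF (sometime ks l) = ⋀ (map litF ks) ⇒' ◇ (litF l)

Satisfiable : List Clause → Set
Satisfiable S = Σ Model λ σ → σ , 0 ⊨ □ (⋀ (map clauseF S))

litSym : Literal → Sym
litSym (pos p) = p
litSym (neg p) = p

litEqᵇ : Literal → Literal → Bool
litEqᵇ (pos p) (pos q) = p ≡ᵇ q
litEqᵇ (neg p) (neg q) = p ≡ᵇ q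
litEqᵇ _ _ = false

clauseLits : Clause → List Literal
clauseLits (initial ls)    = ls
clauseLits (step ks ls)    = foldr _∷_ ls ks
clauseLits (sometime ks l) = l ∷ ks

syms : List Clause → List Sym
syms S = deduplicateᵇ _≡ᵇ_ (map litSym (concatMap clauseLits S))

evLit : Clause → List Literal
evLit (sometime ks l) = l ∷ []
evLit _ = []

evs : List Clause → List Literal
evs S = deduplicateᵇ litEqᵇ (concatMap evLit S)

-- a valuation of the symbols of S: one truth value per symbol
Valuation : List Clause → Set
Valuation S = Vec Bool (length (syms S))

-- a set of eventuality literals of S: one membership bit per literal
EvSet : List Clause → Set
EvSet S = Vec Bool (length (evs S))

valOf : (ps : List Sym) → Vec Bool (length ps) → Sym → Bool
valOf []       []       p = false
valOf (q ∷ ps) (b ∷ bs) p = if p ≡ᵇ q then b else valOf ps bs p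

module _ (S : List Clause) where

  satLit : Valuation S → Literal → Bool
  satLit V (pos p) = valOf (syms S) V p
  satLit V (neg p) = not (valOf (syms S) V p)

  satConj : Valuation S → List Literal → Bool
  satConj V = all (satLit V)

  satDisj : Valuation S → List Literal → Bool
  satDisj V = any (satLit V)

  initOK : Valuation S → Bool
  initOK V = all ok S
    where
    ok : Clause → Bool
    ok (initial ls) = satDisj V ls
    ok _ = true

  stepOK : Valuation S → Valuation S → Bool
  stepOK V V' = all ok S
    where
    ok : Clause → Bool
    ok (step ks ls) = if satConj V ks then satDisj V' ls else true
    ok _ = true

  triggered : Valuation S → EvSet S
  triggered V = Data.Vec.map trig (fromList (evs S))
    where
    trig : Literal → Bool
    trig l = any t S
      where
      t : Clause → Bool
      t (sometime ks l') = litEqᵇ l l' ∧ satConj V ks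
      t _ = false

  unsatisfied : Valuation S → EvSet S → EvSet S
  unsatisfied V E = zipWith (λ b l → b ∧ not (satLit V l)) E (fromList (evs S))

  Node : Set
  Node = Valuation S × EvSet S

  Edge : Node → Node → Set
  Edge (V , E) (V' , E₂) =
    T (stepOK V V') × (E₂ ≡ zipWith _∨_ (unsatisfied V E) (triggered V'))

  Initial : Node → Set
  Initial (V , E) = T (initOK V) × (E ≡ triggered V)

  -- node sets (a graph is the subgraph of the behaviour graph induced by a node set)
  NodeSet : Set₁
  NodeSet = Node → Set

  BG : NodeSet
  BG n = Σ Node λ i → Initial i × Star Edge i n

  GEdge : NodeSet → Node → Node → Set
  GEdge G a b = G a × G b × Edge a b

  Deletable : NodeSet → Node → Set
  Deletable G n = G n ×
    (
      (∀ m → G m → ¬ Edge n m)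
    ⊎
      Σ (Fin (length (evs S))) λ j →
        T (lookup (proj₂ n) j) ×
        ¬ T (satLit (proj₁ n) (lookup (fromList (evs S)) j)) ×
        ¬ (Σ Node λ m → Star (GEdge G) n m ×
              T (satLit (proj₁ m) (lookup (fromList (evs S)) j))))

  data _⟶_ (G : NodeSet) : NodeSet → Set₁ where
    delete : ∀ n → Deletable G n → G ⟶ (λ x → G x × x ≢ n)

  Irreducible : NodeSet → Set
  Irreducible G = ∀ n → ¬ Deletable G n

  IsReducedBG : NodeSet → Set₁
  IsReducedBG R = Star _⟶_ BG R × Irreducible R

  EmptyGraph : NodeSet → Set
  EmptyGraph G = ∀ n → ¬ G n

-- A run of the behaviour graph is an infinite path from an initial node; it is fulfilling
-- if every outstanding eventuality is eventually satisfied. Models of S and fulfilling runs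
-- correspond to each other. The nodes of a fulfilling run are never deletable, so if S is
-- satisfiable, deleting nodes as long as possible ends in a reduced graph that still contains
-- the run. Conversely, in a nonempty reduced graph every node has a successor and reaches
-- every eventuality it owes, and a node whose predecessor in the behaviour graph was deleted
-- would itself owe an unreachable eventuality, so the graph contains an initial node. Walking
-- from it in rounds, each of which serves every eventuality in turn, gives a fulfilling run,
-- and hence a model. Both sides of the equivalence are negative, so excluded middle and
-- choice over the finitely many nodes are available in the double-negation monad.
module Submission where

open import Defs

open import Data.Bool using (Bool; true; false; not; _∧_; _∨_; T; if_then_else_)
open import Data.Bool.Properties using (T-∧; T-∨; _≟_)
open import Data.Empty using (⊥; ⊥-elim)
open import Data.Fin using (Fin)
open import Data.List using (List; []; _∷_; map; length; allFin; filter; cartesianProduct; cartesianProductWith)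
open import Data.List.Membership.Propositional using (_∈_; find; lose)
open import Data.List.Membership.Propositional.Properties
  using (∈-allFin; ∈-concatMap⁺; ∈-map⁺; ∈-cartesianProduct⁺; ∈-cartesianProductWith⁺)
open import Data.List.Properties using (++-is-foldr)
open import Data.List.Relation.Unary.All as All using (All; []; _∷_)
open import Data.List.Relation.Unary.All.Properties using (all⁺; all⁻; ++⁻)
open import Data.List.Relation.Unary.Any using (here; there; index)
open import Data.List.Relation.Unary.Any.Properties using (any⁺; any⁻; deduplicate⁺)
open import Data.Nat using (ℕ; zero; suc; _≤_; _<_; _+_; _≤′_; ≤′-refl; ≤′-step; z≤n; s≤s; _≡ᵇ_)
open import Data.Nat.Properties
  using (≡ᵇ⇒≡; ≡⇒≡ᵇ; ≤⇒≤′; ≤∧≢⇒<; <-≤-trans; ≤-pred; n<1+n; m≤n⇒m≤1+n; m≤m+n)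
open import Data.Product using (Σ; _×_; _,_; proj₁; proj₂)
open import Data.Product.Function.NonDependent.Propositional using (_×-⇔_)
open import Data.Product.Properties using () renaming (≡-dec to ×-≡-dec)
open import Data.Sum using (_⊎_; inj₁; inj₂; [_,_])
open import Data.Sum.Function.Propositional using (_⊎-⇔_)
open import Data.Unit using (tt)
open import Data.Vec as Vec using (Vec; []; _∷_; lookup; fromList; zipWith)
open import Data.Vec.Properties using (lookup-map; lookup-zipWith) renaming (≡-dec to Vec-≡-dec)
open import Function using (_∘_; case_of_)
open import Function.Bundles using (_⇔_; mk⇔; Equivalence)
open import Function.Construct.Composition using (_⇔-∘_)
open import Function.Construct.Identity using (⇔-id)
open import Relation.Binary.Construct.Closure.ReflexiveTransitive using (Star; ε; _◅_; _◅◅_)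
import Relation.Binary.Construct.Closure.ReflexiveTransitive as Star
open import Relation.Binary.Definitions using (DecidableEquality)
open import Relation.Binary.PropositionalEquality using (_≡_; _≢_; refl; sym; trans; cong; subst)
open import Relation.Nullary
  using (¬_; ¬?; Dec; yes; no; contradiction; ¬¬-excluded-middle; T?; _×-dec_)
open import Relation.Unary using (_⊆_; Decidable)

open Equivalence using (to; from)

private variable
  A : Set
  n : ℕ

T-not : ∀ {b} → T (not b) ⇔ (¬ T b)
T-not {true}  = mk⇔ (λ ()) (λ ¬t → ¬t tt)
T-not {false} = mk⇔ (λ _ ()) (λ _ → tt)

T-if⇔ : ∀ {b x} → T (if b then x else true) ⇔ (T b → T x)
T-if⇔ {true}  = mk⇔ (λ t _ → t) (λ f → f tt)
T-if⇔ {false} = mk⇔ (λ _ ()) _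

¬¬-All : {P : A → Set} → (∀ x → ¬ ¬ P x) → ∀ xs → ¬ ¬ All P xs
¬¬-All f []       k = k []
¬¬-All f (x ∷ xs) k = f x λ px → ¬¬-All f xs λ pxs → k (px ∷ pxs)

¬¬-∀-enumerated : {P : A → Set} (xs : List A) → (∀ x → x ∈ xs) →
                  (∀ x → ¬ ¬ P x) → ¬ ¬ (∀ x → P x)
¬¬-∀-enumerated xs complete f k = ¬¬-All f xs λ pxs → k λ x → All.lookup pxs (complete x)

¬¬-→ : {B C : Set} → (B → ¬ ¬ C) → ¬ ¬ (B → C)
¬¬-→ f k = k λ b → ⊥-elim (f b λ c → k λ _ → c)

bools : List Bool
bools = true ∷ false ∷ []

∈-bools : ∀ b → b ∈ bools
∈-bools true  = here refl
∈-bools false = there (here refl)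

vectors : List A → ∀ n → List (Vec A n)
vectors xs zero    = [] ∷ []
vectors xs (suc n) = cartesianProductWith _∷_ xs (vectors xs n)

∈-vectors : {xs : List A} → (∀ x → x ∈ xs) → (v : Vec A n) → v ∈ vectors xs n
∈-vectors complete []      = here refl
∈-vectors complete (x ∷ v) = ∈-cartesianProductWith⁺ _∷_ (complete x) (∈-vectors complete v)

module _ {P Q : A → Set} (P? : Decidable P) (Q? : Decidable Q) (Q⊆P : Q ⊆ P) where

  length-filter-mono : ∀ xs → length (filter Q? xs) ≤ length (filter P? xs)
  length-filter-mono []       = z≤n
  length-filter-mono (x ∷ xs) with P? x | Q? x
  ... | yes _ | yes _ = s≤s (length-filter-mono xs)
  ... | yes _ | no  _ = m≤n⇒m≤1+n (length-filter-mono xs)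
  ... | no ¬p | yes q = contradiction (Q⊆P q) ¬p
  ... | no  _ | no  _ = length-filter-mono xs

  length-filter-strict : ∀ {x xs} → x ∈ xs → P x → ¬ Q x →
                         length (filter Q? xs) < length (filter P? xs)
  length-filter-strict {xs = y ∷ xs} (here refl) p ¬q with P? y | Q? y
  ... | no ¬p | _     = contradiction p ¬p
  ... | yes _ | yes q = contradiction q ¬q
  ... | yes _ | no  _ = s≤s (length-filter-mono xs)
  length-filter-strict {xs = y ∷ xs} (there x∈xs) p ¬q with P? y | Q? y
  ... | yes _ | yes _ = s≤s (length-filter-strict x∈xs p ¬q)
  ... | yes _ | no  _ = m≤n⇒m≤1+n (length-filter-strict x∈xs p ¬q)
  ... | no ¬p | yes q = contradiction (Q⊆P q) ¬p
  ... | no  _ | no  _ = length-filter-strict x∈xs p ¬q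

lookup-fromList-index : ∀ {x : A} {xs} (x∈xs : x ∈ xs) → lookup (fromList xs) (index x∈xs) ≡ x
lookup-fromList-index (here refl)  = refl
lookup-fromList-index (there x∈xs) = lookup-fromList-index x∈xs

chain-path : {_↝_ : A → A → Set} {f : ℕ → A} → (∀ t → f t ↝ f (suc t)) →
             ∀ {t k} → t ≤′ k → Star _↝_ (f t) (f k)
chain-path next ≤′-refl            = ε
chain-path next (≤′-step {k} t≤′k) = chain-path next t≤′k ◅◅ (next k ◅ ε)

module _ {N : Set} {_↝_ : N → N → Set} where

  data Passes (P : N → Set) : ∀ {a b} → Star _↝_ a b → Set where
    here  : ∀ {a b} {p : Star _↝_ a b} → P a → Passes P p
    there : ∀ {a b c} {e : a ↝ b} {p : Star _↝_ b c} → Passes P p → Passes P (e ◅ p)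

  module _ {P : N → Set} where

    passes-end : ∀ {a b} (p : Star _↝_ a b) → P b → Passes P p
    passes-end ε       pb = here pb
    passes-end (e ◅ p) pb = there (passes-end p pb)

    passes-◅◅ˡ : ∀ {a b c} {p : Star _↝_ a b} {q : Star _↝_ b c} → Passes P p → Passes P (p ◅◅ q)
    passes-◅◅ˡ (here pa)  = here pa
    passes-◅◅ˡ (there pp) = there (passes-◅◅ˡ pp)

    passes-◅◅ʳ : ∀ {a b c} (p : Star _↝_ a b) {q : Star _↝_ b c} → Passes P q → Passes P (p ◅◅ q)
    passes-◅◅ʳ ε       pq = pq
    passes-◅◅ʳ (e ◅ p) pq = there (passes-◅◅ʳ p pq)

-- A round first takes one step and then serves every eventuality in turn, so an eventuality
-- outstanding anywhere on the walk holds at the latest during the next round.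
module FairWalk
  {N : Set} (_↝_ : N → N → Set) {K : ℕ} (Out Holds : N → Fin K → Set)
  (out? : ∀ a j → Dec (Out a j)) (holds? : ∀ a j → Dec (Holds a j))
  (persists : ∀ {a b j} → a ↝ b → Out a j → ¬ Holds a j → Out b j)
  (successor : ∀ a → Σ N (a ↝_))
  (reach : ∀ a j → Out a j → ¬ Holds a j → Σ N λ b → Star _↝_ a b × Holds b j)
  where

  Serves : ∀ {a b} → Star _↝_ a b → Fin K → Set
  Serves {a} p j = Out a j → Passes (λ x → Holds x j) p

  passes-or-persists : ∀ {a b j} (p : Star _↝_ a b) → Out a j → Passes (λ x → Holds x j) p ⊎ Out b j
  passes-or-persists ε o = inj₂ o
  passes-or-persists {a} {j = j} (e ◅ p) o with holds? a j
  ... | yes h = inj₁ (here h)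
  ... | no ¬h with passes-or-persists p (persists e o ¬h)
  ...   | inj₁ pp = inj₁ (there pp)
  ...   | inj₂ o′ = inj₂ o′

  serve : ∀ a j → Σ N λ b → Σ (Star _↝_ a b) λ p → Serves p j
  serve a j with holds? a j | out? a j
  ... | yes h | _     = a , ε , λ _ → here h
  ... | no ¬h | yes o = let b , p , hb = reach a j o ¬h in b , p , λ _ → passes-end p hb
  ... | no ¬h | no ¬o = a , ε , λ o → contradiction o ¬o

  serveAll : ∀ js a → Σ N λ b → Σ (Star _↝_ a b) λ p → ∀ {j} → j ∈ js → Serves p j
  serveAll []       a = a , ε , λ ()
  serveAll (j ∷ js) a =
    let b , p , p-serves = serve a j
        c , q , q-serves = serveAll js b
    in c , p ◅◅ q , λ where
      (here refl)  o → passes-◅◅ˡ (p-serves o)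
      (there j∈js) o → [ passes-◅◅ˡ , (λ o′ → passes-◅◅ʳ p (q-serves j∈js o′)) ]
                         (passes-or-persists p o)

  record Round (a : N) : Set where
    field
      {next end} : N
      first      : a ↝ next
      rest       : Star _↝_ next end
      serves     : ∀ j → Serves (first ◅ rest) j

  round : ∀ a → Round a
  round a = record { first = e ; rest = proj₁ (proj₂ swept) ; serves = serves }
    where
    b : N
    b = proj₁ (successor a)

    e : a ↝ b
    e = proj₂ (successor a)

    swept : Σ N λ c → Σ (Star _↝_ b c) λ p → ∀ {j} → j ∈ allFin K → Serves p j
    swept = serveAll (allFin K) b

    serves : ∀ j → Serves (e ◅ proj₁ (proj₂ swept)) j
    serves j o with holds? a j
    ... | yes h = here h
    ... | no ¬h = there (proj₂ (proj₂ swept) (∈-allFin j) (persists e o ¬h))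

  -- the current node and the part of the current round still to be walked
  State : Set
  State = Σ N λ a → Σ N (Star _↝_ a)

  advance : State → State
  advance (a , b , e ◅ p) = _ , b , p
  advance (a , _ , ε)     = let open Round (round a) in next , end , rest

  advance-↝ : ∀ s → proj₁ s ↝ proj₁ (advance s)
  advance-↝ (a , b , e ◅ p) = e
  advance-↝ (a , _ , ε)     = Round.first (round a)

  _after_ : State → ℕ → State
  s after zero  = s
  s after suc k = advance s after k

  after-suc : ∀ s k → s after suc k ≡ advance (s after k)
  after-suc s zero    = refl
  after-suc s (suc k) = after-suc (advance s) k

  after-+ : ∀ s t k → (s after t) after k ≡ s after (t + k)
  after-+ s zero    k = refl
  after-+ s (suc t) k = after-+ (advance s) t k

  Meets : State → Fin K → Set
  Meets s j = Σ ℕ λ k → Holds (proj₁ (s after k)) j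

  passes⇒meets : ∀ {a b j} (p : Star _↝_ a b) → Passes (λ x → Holds x j) p → Meets (a , b , p) j
  passes⇒meets p       (here h)   = zero , h
  passes⇒meets (e ◅ p) (there pp) = let k , h = passes⇒meets p pp in suc k , h

  outstanding⇒meets : ∀ {a b j} (p : Star _↝_ a b) → Out a j → Meets (a , b , p) j
  outstanding⇒meets {a} {j = j} ε o with Round.serves (round a) j o
  ... | here h   = zero , h
  ... | there pp = let k , h = passes⇒meets (Round.rest (round a)) pp in suc k , h
  outstanding⇒meets {a} {j = j} (e ◅ p) o with holds? a j
  ... | yes h = zero , h
  ... | no ¬h = let k , h = outstanding⇒meets p (persists e o ¬h) in suc k , h

  walk : N → ℕ → N
  walk a t = proj₁ ((a , a , ε) after t)

  walk-↝ : ∀ a t → walk a t ↝ walk a (suc t)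
  walk-↝ a t = subst (λ s → walk a t ↝ proj₁ s) (sym (after-suc (a , a , ε) t))
                     (advance-↝ ((a , a , ε) after t))

  walk-fair : ∀ a t j → Out (walk a t) j → Σ ℕ λ k → t ≤ k × Holds (walk a k) j
  walk-fair a t j o =
    let k , h = outstanding⇒meets (proj₂ (proj₂ ((a , a , ε) after t))) o
    in t + k , m≤m+n t k , subst (λ s → Holds (proj₁ s) j) (after-+ (a , a , ε) t k) h

⊨-⋀-map : ∀ {σ t} (f : A → Formula) xs → (σ , t ⊨ ⋀ (map f xs)) ⇔ All (λ x → σ , t ⊨ f x) xs
⊨-⋀-map f []       = mk⇔ (λ _ → []) _
⊨-⋀-map f (x ∷ xs) = mk⇔ (λ (a , as) → a ∷ to (⊨-⋀-map f xs) as)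
                          (λ { (a ∷ as) → a , from (⊨-⋀-map f xs) as })

valOf-map : ∀ (f : Sym → Bool) {ps p} → p ∈ ps → valOf ps (Vec.map f (fromList ps)) p ≡ f p
valOf-map f {q ∷ ps} {p} p∈ps with p ≡ᵇ q in eq
... | true = cong f (sym (≡ᵇ⇒≡ p q (subst T (sym eq) tt)))
valOf-map f {p = p} (here refl)  | false = ⊥-elim (subst T eq (≡⇒≡ᵇ p p refl))
valOf-map f         (there p∈ps) | false = valOf-map f p∈ps

litEqᵇ⇒≡ : ∀ {l l′} → T (litEqᵇ l l′) → l ≡ l′
litEqᵇ⇒≡ {pos p} {pos q} t = cong pos (≡ᵇ⇒≡ p q t)
litEqᵇ⇒≡ {neg p} {neg q} t = cong neg (≡ᵇ⇒≡ p q t)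

litEqᵇ-refl : ∀ l → T (litEqᵇ l l)
litEqᵇ-refl (pos p) = ≡⇒≡ᵇ p p refl
litEqᵇ-refl (neg p) = ≡⇒≡ᵇ p p refl

module _ (S : List Clause) where

  EvIndex : Set
  EvIndex = Fin (length (evs S))

  eventuality : EvIndex → Literal
  eventuality j = lookup (fromList (evs S)) j

  Outstanding : Node S → EvIndex → Set
  Outstanding n j = T (lookup (proj₂ n) j)

  Holds : Node S → EvIndex → Set
  Holds n j = T (satLit S (proj₁ n) (eventuality j))

  Triggered : Valuation S → EvIndex → Set
  Triggered V j = T (lookup (triggered S V) j)

  outstanding-after-edge : ∀ {a b} → Edge S a b → ∀ j →
    Outstanding b j ⇔ ((Outstanding a j × ¬ Holds a j) ⊎ Triggered (proj₁ b) j)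
  outstanding-after-edge {V , E} {V′ , _} (_ , refl) j
    rewrite lookup-zipWith _∨_ j (unsatisfied S V E) (triggered S V′)
          | lookup-zipWith (λ b l → b ∧ not (satLit S V l)) j E (fromList (evs S))
    = ((⇔-id _ ×-⇔ T-not) ⇔-∘ T-∧ ⊎-⇔ ⇔-id _) ⇔-∘ T-∨

  ∈-evs : ∀ {ks l} → sometime ks l ∈ S → l ∈ evs S
  ∈-evs C∈S = deduplicate⁺ _ (λ r e → trans e (sym (litEqᵇ⇒≡ r)))
                (∈-concatMap⁺ evLit (lose C∈S (here refl)))

  ∈-syms : ∀ {C l} → C ∈ S → l ∈ clauseLits C → litSym l ∈ syms S
  ∈-syms C∈S l∈C = deduplicate⁺ _ (λ r e → trans e (sym (≡ᵇ⇒≡ _ _ r)))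
                     (∈-map⁺ litSym (∈-concatMap⁺ clauseLits (lose C∈S l∈C)))

  triggered⁺ : ∀ V {ks l} → sometime ks l ∈ S → T (satConj S V ks) →
               Σ EvIndex λ j → eventuality j ≡ l × Triggered V j
  triggered⁺ V {ks} {l} C∈S ks-hold =
    j , j↦l , subst T (sym (lookup-map j _ (fromList (evs S)))) (any⁺ _ (lose C∈S C-fires))
    where
    j : EvIndex
    j = index (∈-evs C∈S)

    j↦l : eventuality j ≡ l
    j↦l = lookup-fromList-index (∈-evs C∈S)

    C-fires : T (litEqᵇ (eventuality j) l ∧ satConj S V ks)
    C-fires = from T-∧ (subst (λ l′ → T (litEqᵇ l′ l)) (sym j↦l) (litEqᵇ-refl l) , ks-hold)

  triggered⁻ : ∀ V j → Triggered V j →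
               Σ (List Literal) λ ks → sometime ks (eventuality j) ∈ S × T (satConj S V ks)
  triggered⁻ V j tr with find (any⁻ _ S (subst T (lookup-map j _ (fromList (evs S))) tr))
  ... | sometime ks l , C∈S , t with litEqᵇ⇒≡ {eventuality j} (proj₁ (to T-∧ t))
  ...   | refl = ks , C∈S , proj₂ (to T-∧ t)

  -- valuations only record the symbols of S, and valOf reads every other symbol as false
  Agrees : Model → ℕ → Valuation S → Literal → Set
  Agrees σ t V l = valOf (syms S) V (litSym l) ≡ σ t (litSym l)

  module _ {σ : Model} {t : ℕ} {V : Valuation S} where

    literal⇔ : ∀ {l} → Agrees σ t V l → T (satLit S V l) ⇔ (σ , t ⊨ litF l)
    literal⇔ {pos p} eq rewrite eq = ⇔-id _
    literal⇔ {neg p} eq rewrite eq = T-not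

    conjunction⇔ : ∀ {ks} → All (Agrees σ t V) ks → T (satConj S V ks) ⇔ (σ , t ⊨ ⋀ (map litF ks))
    conjunction⇔          []       = mk⇔ _ _
    conjunction⇔ {k ∷ _} (a ∷ as) = (literal⇔ {k} a ×-⇔ conjunction⇔ as) ⇔-∘ T-∧

    disjunction⇔ : ∀ {ls} → All (Agrees σ t V) ls → T (satDisj S V ls) ⇔ (σ , t ⊨ ⋁ (map litF ls))
    disjunction⇔          []       = mk⇔ (λ ()) (λ ())
    disjunction⇔ {l ∷ _} (a ∷ as) = (literal⇔ {l} a ⊎-⇔ disjunction⇔ as) ⇔-∘ T-∨

  IsRun : (ℕ → Node S) → Set
  IsRun ν = Initial S (ν 0) × (∀ t → Edge S (ν t) (ν (suc t)))

  EventuallyHolds : (ℕ → Node S) → ℕ → EvIndex → Set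
  EventuallyHolds ν t j = Σ ℕ λ k → t ≤ k × Holds (ν k) j

  Fulfilling : (ℕ → Node S) → Set
  Fulfilling ν = ∀ t j → Outstanding (ν t) j → EventuallyHolds ν t j

  module _ {ν : ℕ → Node S} (run : IsRun ν) where

    private
      ν₀-initial : Initial S (ν 0)
      ν₀-initial = proj₁ run

      edge : ∀ t → Edge S (ν t) (ν (suc t))
      edge = proj₂ run

    run-triggered⇒outstanding : ∀ t j → Triggered (proj₁ (ν t)) j → Outstanding (ν t) j
    run-triggered⇒outstanding zero    j tr rewrite proj₂ ν₀-initial = tr
    run-triggered⇒outstanding (suc t) j tr = from (outstanding-after-edge (edge t) j) (inj₂ tr)

    triggers-fulfilled⇒fulfilling : (∀ t j → Triggered (proj₁ (ν t)) j → EventuallyHolds ν t j) →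
                                    Fulfilling ν
    triggers-fulfilled⇒fulfilling fulfilled zero j o rewrite proj₂ ν₀-initial = fulfilled zero j o
    triggers-fulfilled⇒fulfilling fulfilled (suc t) j o with to (outstanding-after-edge (edge t) j) o
    ... | inj₂ tr        = fulfilled (suc t) j tr
    ... | inj₁ (o′ , ¬h) with triggers-fulfilled⇒fulfilling fulfilled t j o′
    ...   | k , t≤k , h = k , ≤∧≢⇒< t≤k (λ { refl → ¬h h }) , h

    run-in-BG : ∀ t → BG S (ν t)
    run-in-BG t = ν 0 , ν₀-initial , chain-path edge (≤⇒≤′ z≤n)

  fulfilling-run⇒satisfiable : ∀ {ν} → IsRun ν → Fulfilling ν → Satisfiable S
  fulfilling-run⇒satisfiable {ν} run@(ν₀-initial , edge) fulfilling =
    σ , λ t _ → from (⊨-⋀-map clauseF S) (All.tabulate (clause-holds t))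
    where
    σ : Model
    σ t = valOf (syms S) (proj₁ (ν t))

    agrees : ∀ t ls → All (Agrees σ t (proj₁ (ν t))) ls
    agrees t = All.universal (λ _ → refl)

    clause-holds : ∀ t {C} → C ∈ S → σ , t ⊨ clauseF C
    clause-holds t {initial ls} C∈S refl =
      to (disjunction⇔ (agrees 0 ls)) (All.lookup (all⁺ _ S (proj₁ ν₀-initial)) C∈S)
    clause-holds t {step ks ls} C∈S ks-hold =
      to (disjunction⇔ (agrees (suc t) ls))
         (to T-if⇔ (All.lookup (all⁺ _ S (proj₁ (edge t))) C∈S)
                   (from (conjunction⇔ (agrees t ks)) ks-hold))
    clause-holds t {sometime ks l} C∈S ks-hold
      with triggered⁺ (proj₁ (ν t)) C∈S (from (conjunction⇔ (agrees t ks)) ks-hold)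
    ... | j , refl , tr with fulfilling t j (run-triggered⇒outstanding run t j tr)
    ...   | k , t≤k , h = k , t≤k , to (literal⇔ {l = l} refl) h

  satisfiable⇒fulfilling-run : Satisfiable S → Σ (ℕ → Node S) λ ν → IsRun ν × Fulfilling ν
  satisfiable⇒fulfilling-run (σ , σ⊨S) = ν , run , triggers-fulfilled⇒fulfilling run triggered-fulfilled
    where
    V : ℕ → Valuation S
    V t = Vec.map (σ t) (fromList (syms S))

    E : ℕ → EvSet S
    E zero    = triggered S (V 0)
    E (suc t) = zipWith _∨_ (unsatisfied S (V t) (E t)) (triggered S (V (suc t)))

    ν : ℕ → Node S
    ν t = V t , E t

    clause-holds : ∀ t {C} → C ∈ S → σ , t ⊨ clauseF C
    clause-holds t = All.lookup (to (⊨-⋀-map clauseF S) (σ⊨S t z≤n))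

    agrees : ∀ t {C} → C ∈ S → All (Agrees σ t (V t)) (clauseLits C)
    agrees t C∈S = All.tabulate λ l∈C → valOf-map (σ t) (∈-syms C∈S l∈C)

    agrees-step : ∀ t {ks ls} → step ks ls ∈ S →
                  All (Agrees σ t (V t)) ks × All (Agrees σ (suc t) (V (suc t))) ls
    agrees-step t {ks} {ls} C∈S =
      proj₁ (split (agrees t C∈S)) , proj₂ (split (agrees (suc t) C∈S))
      where
      split : ∀ {P : Literal → Set} → All P (clauseLits (step ks ls)) → All P ks × All P ls
      split = ++⁻ ks ∘ subst (All _) (sym (++-is-foldr ks ls))

    -- initOK and stepOK are `all` over S of a clause test local to Defs, checked clause by clause
    run : IsRun ν
    run = ( all⁻ _ {xs = S} (All.tabulate λ
              { {initial ls}   C∈S → from (disjunction⇔ (agrees 0 C∈S)) (clause-holds 0 C∈S refl)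
              ; {step _ _}     _   → tt
              ; {sometime _ _} _   → tt })
          , refl )
        , λ t → all⁻ _ {xs = S} (All.tabulate λ
              { {initial _}    _   → tt
              ; {step ks ls}   C∈S → let ks-agree , ls-agree = agrees-step t C∈S in
                  from T-if⇔ λ ks-hold →
                    from (disjunction⇔ ls-agree) (clause-holds t C∈S (to (conjunction⇔ ks-agree) ks-hold))
              ; {sometime _ _} _   → tt })
          , refl

    triggered-fulfilled : ∀ t j → Triggered (V t) j → EventuallyHolds ν t j
    triggered-fulfilled t j tr with triggered⁻ (V t) j tr
    ... | ks , C∈S , ks-hold with agrees t C∈S
    ...   | _ ∷ ks-agree with clause-holds t C∈S (to (conjunction⇔ ks-agree) ks-hold)
    ...     | k , t≤k , l-holds =
      k , t≤k , from (literal⇔ {l = eventuality j} (All.head (agrees k C∈S))) l-holds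

  Stranded : NodeSet S → Node S → Set
  Stranded G n = Σ EvIndex λ j → Outstanding n j × ¬ Holds n j ×
                   ¬ Σ (Node S) λ m → Star (GEdge S G) n m × Holds m j

  fulfilling-run-undeletable : ∀ {ν G} → IsRun ν → Fulfilling ν → (∀ t → G (ν t)) →
                               ∀ t → ¬ Deletable S G (ν t)
  fulfilling-run-undeletable (_ , edge) fulfilling inG t (_ , inj₁ no-successor) =
    no-successor _ (inG (suc t)) (edge t)
  fulfilling-run-undeletable (_ , edge) fulfilling inG t (_ , inj₂ (j , o , _ , unreachable)) =
    let k , t≤k , h = fulfilling t j o
    in unreachable (_ , chain-path (λ t → inG t , inG (suc t) , edge t) (≤⇒≤′ t≤k) , h)

  GEdge*-mono : ∀ {G G′ : NodeSet S} → G′ ⊆ G → ∀ {a b} → Star (GEdge S G′) a b → Star (GEdge S G) a b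
  GEdge*-mono G′⊆G = Star.map λ (Ga , Gb , e) → G′⊆G Ga , G′⊆G Gb , e

  stranded-anti-mono : ∀ {G G′ : NodeSet S} → G′ ⊆ G → ∀ {n} → Stranded G n → Stranded G′ n
  stranded-anti-mono G′⊆G (j , o , ¬h , unreachable) =
    j , o , ¬h , λ (m , path , h) → unreachable (m , GEdge*-mono G′⊆G path , h)

  stranded-successor : ∀ {G a b} → G a → G b → Edge S a b → Stranded G a → Stranded G b
  stranded-successor Ga Gb e (j , o , ¬h , unreachable) =
    j , from (outstanding-after-edge e j) (inj₁ (o , ¬h)) ,
    (λ h → unreachable (_ , (Ga , Gb , e) ◅ ε , h)) ,
    λ (m , path , h) → unreachable (m , (Ga , Gb , e) ◅ path , h)

  deletions-shrink : ∀ {G R} → Star (_⟶_ S) G R → R ⊆ G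
  deletions-shrink ε                    Rx = Rx
  deletions-shrink (delete _ _ ◅ steps) Rx = proj₁ (deletions-shrink steps Rx)

  _≟ᴺ_ : DecidableEquality (Node S)
  _≟ᴺ_ = ×-≡-dec (Vec-≡-dec _≟_) (Vec-≡-dec _≟_)

  EdgesFromDeletedStrand : NodeSet S → Set
  EdgesFromDeletedStrand G = ∀ {p n} → BG S p → ¬ G p → Edge S p n → G n → ¬ ¬ Stranded G n

  deletion-preserves-strands : ∀ {G d} → EdgesFromDeletedStrand G → Deletable S G d →
                               EdgesFromDeletedStrand (λ x → G x × x ≢ d)
  deletion-preserves-strands {G} {d} strands (_ , reason) {p} {n} BGp ¬G′p e (Gn , _) k =
    ¬¬-excluded-middle λ where
      (no ¬Gp) → strands BGp ¬Gp e Gn (k ∘ stranded-anti-mono proj₁)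
      (yes Gp) → predecessor-deleted Gp (p ≟ᴺ d)
    where
    predecessor-deleted : G p → Dec (p ≡ d) → ⊥
    predecessor-deleted Gp (no p≢d)  = ¬G′p (Gp , p≢d)
    predecessor-deleted Gp (yes refl) = case reason of λ where
      (inj₁ no-successor) → no-successor n Gn e
      (inj₂ stranded)     → k (stranded-anti-mono proj₁ (stranded-successor Gp Gn e stranded))

  deletions-strand : ∀ {R} → Star (_⟶_ S) (BG S) R → EdgesFromDeletedStrand R
  deletions-strand = preserve (λ BGp ¬BGp → contradiction BGp ¬BGp)
    where
    preserve : ∀ {G R} → EdgesFromDeletedStrand G → Star (_⟶_ S) G R → EdgesFromDeletedStrand R
    preserve strands ε                            = strands
    preserve strands (delete _ deletable ◅ steps) =
      preserve (deletion-preserves-strands strands deletable) steps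

  reduced-closed-under-predecessors : ∀ {R a b} → IsReducedBG S R → BG S a → Star (Edge S) a b →
                                      R b → ¬ ¬ R a
  reduced-closed-under-predecessors _ _ ε Rb ¬Rb = ¬Rb Rb
  reduced-closed-under-predecessors reduced@(steps , irreducible) BGa (e ◅ path) Rb ¬Ra =
    reduced-closed-under-predecessors reduced (BG-successor BGa e) path Rb λ Rc →
    deletions-strand steps BGa ¬Ra e Rc λ stranded → irreducible _ (Rc , inj₂ stranded)
    where
    BG-successor : ∀ {a b} → BG S a → Edge S a b → BG S b
    BG-successor (i , i-initial , i→a) e = i , i-initial , i→a ◅◅ (e ◅ ε)

  module _ {R : NodeSet S}
    (successor : ∀ n → R n → Σ (Node S) λ m → R m × Edge S n m)
    (reach : ∀ n j → R n × Outstanding n j × ¬ Holds n j →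
             Σ (Node S) λ m → Star (GEdge S R) n m × Holds m j)
    where

    private
      Vertex : Set
      Vertex = Σ (Node S) R

      data _↝_ : Vertex → Vertex → Set where
        edge : ∀ {a b Ra Rb} → Edge S a b → (a , Ra) ↝ (b , Rb)

      edge⁻¹ : ∀ {a b} → a ↝ b → Edge S (proj₁ a) (proj₁ b)
      edge⁻¹ (edge e) = e

      lift : ∀ {a b} → Star (GEdge S R) a b → (Ra : R a) → Σ (R b) λ Rb → Star _↝_ (a , Ra) (b , Rb)
      lift ε                     Ra = Ra , ε
      lift ((_ , Rb , e) ◅ path) _  = let Rc , path′ = lift path Rb in Rc , edge e ◅ path′

      persists : ∀ {a b : Vertex} {j} → a ↝ b → Outstanding (proj₁ a) j → ¬ Holds (proj₁ a) j →
                 Outstanding (proj₁ b) j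
      persists (edge e) o ¬h = from (outstanding-after-edge e _) (inj₁ (o , ¬h))

      successor′ : ∀ (a : Vertex) → Σ Vertex (a ↝_)
      successor′ (a , Ra) with successor a Ra
      ... | b , Rb , e = (b , Rb) , edge e

      reach′ : ∀ (a : Vertex) j → Outstanding (proj₁ a) j → ¬ Holds (proj₁ a) j →
               Σ Vertex λ b → Star _↝_ a b × Holds (proj₁ b) j
      reach′ (a , Ra) j o ¬h with reach a j (Ra , o , ¬h)
      ... | b , path , h with lift path Ra
      ...   | Rb , path′ = (b , Rb) , path′ , h

      outstanding? : ∀ (a : Vertex) j → Dec (Outstanding (proj₁ a) j)
      outstanding? _ _ = T? _

      holds? : ∀ (a : Vertex) j → Dec (Holds (proj₁ a) j)
      holds? _ _ = T? _

      open FairWalk _↝_ (λ (a : Vertex) → Outstanding (proj₁ a)) (λ (a : Vertex) → Holds (proj₁ a))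
        outstanding? holds? persists successor′ reach′
        using (walk; walk-↝; walk-fair)

    fulfilling-run-from : ∀ {i} → R i → Initial S i → Σ (ℕ → Node S) λ ν → IsRun ν × Fulfilling ν
    fulfilling-run-from {i} Ri i-initial =
      proj₁ ∘ walk (i , Ri) , (i-initial , edge⁻¹ ∘ walk-↝ (i , Ri)) , walk-fair (i , Ri)

  nodes : List (Node S)
  nodes = cartesianProduct (vectors bools _) (vectors bools _)

  ∈-nodes : ∀ n → n ∈ nodes
  ∈-nodes (V , E) = ∈-cartesianProduct⁺ (∈-vectors ∈-bools V) (∈-vectors ∈-bools E)

  reduced-nonempty⇒¬¬fulfilling-run : ∀ {R n} → IsReducedBG S R → R n →
                                      ¬ ¬ Σ (ℕ → Node S) λ ν → IsRun ν × Fulfilling ν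
  reduced-nonempty⇒¬¬fulfilling-run {R} reduced@(steps , irreducible) Rn k =
    let i , i-initial , i→n = deletions-shrink steps Rn in
    reduced-closed-under-predecessors reduced (i , i-initial , ε) i→n Rn λ Ri →
    ¬¬-∀-enumerated nodes ∈-nodes (¬¬-→ ∘ successor-exists) λ successor →
    ¬¬-∀-enumerated nodes ∈-nodes
      (λ n → ¬¬-∀-enumerated (allFin _) ∈-allFin (¬¬-→ ∘ reach-exists n)) λ reach →
    k (fulfilling-run-from successor reach Ri i-initial)
    where
    successor-exists : ∀ n → R n → ¬ ¬ Σ (Node S) λ m → R m × Edge S n m
    successor-exists n Rn none = irreducible n (Rn , inj₁ λ m Rm e → none (m , Rm , e))

    reach-exists : ∀ n j → R n × Outstanding n j × ¬ Holds n j →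
                   ¬ ¬ Σ (Node S) λ m → Star (GEdge S R) n m × Holds m j
    reach-exists n j (Rn , o , ¬h) unreachable =
      irreducible n (Rn , inj₂ (j , o , ¬h , unreachable))

  module _ (M : NodeSet S) (undeletable : ∀ {G} → M ⊆ G → ∀ {n} → M n → ¬ Deletable S G n) where

    reduce : ∀ fuel {G} (G? : Decidable G) → length (filter G? nodes) < fuel →
             Star (_⟶_ S) (BG S) G → M ⊆ G → ¬ ¬ Σ (NodeSet S) λ R → IsReducedBG S R × M ⊆ R
    reduce (suc fuel) {G} G? size<fuel steps M⊆G k = ¬¬-excluded-middle λ d? → continue d? k
      where
      without? : ∀ d → Decidable (λ x → G x × x ≢ d)
      without? d x = G? x ×-dec ¬? (x ≟ᴺ d)

      smaller : ∀ {d} → Deletable S G d → length (filter (without? d) nodes) < fuel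
      smaller {d} (Gd , _) =
        <-≤-trans (length-filter-strict G? (without? d) proj₁ (∈-nodes d) Gd (λ (_ , d≢d) → d≢d refl))
                  (≤-pred size<fuel)

      M-kept : ∀ {d} → Deletable S G d → M ⊆ (λ x → G x × x ≢ d)
      M-kept deletable Mx = M⊆G Mx , λ { refl → undeletable M⊆G Mx deletable }

      continue : Dec (Σ (Node S) (Deletable S G)) → ¬ ¬ Σ (NodeSet S) λ R → IsReducedBG S R × M ⊆ R
      continue (no none) k = k (G , (steps , λ n deletable → none (n , deletable)) , M⊆G)
      continue (yes (d , deletable)) =
        reduce fuel (without? d) (smaller deletable) (steps ◅◅ (delete d deletable ◅ ε)) (M-kept deletable)

  fulfilling-run⇒¬¬reduced-nonempty : ∀ {ν} → IsRun ν → Fulfilling ν →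
                                      ¬ ¬ Σ (NodeSet S) λ R → IsReducedBG S R × Σ (Node S) R
  fulfilling-run⇒¬¬reduced-nonempty {ν} run fulfilling k =
    ¬¬-∀-enumerated nodes ∈-nodes (λ _ → ¬¬-excluded-middle) λ BG? →
    reduce OnRun undeletable _ BG? (n<1+n _) ε (λ { (t , refl) → run-in-BG run t })
      λ (R , reduced , OnRun⊆R) → k (R , reduced , ν 0 , OnRun⊆R (0 , refl))
    where
    OnRun : NodeSet S
    OnRun n = Σ ℕ λ t → ν t ≡ n

    undeletable : ∀ {G} → OnRun ⊆ G → ∀ {n} → OnRun n → ¬ Deletable S G n
    undeletable OnRun⊆G (t , refl) =
      fulfilling-run-undeletable run fulfilling (λ t → OnRun⊆G (t , refl)) t

lemma11 : (S : List Clause) →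
    (¬ Satisfiable S) ⇔ (∀ R → IsReducedBG S R → EmptyGraph S R)
lemma11 S = mk⇔ unsatisfiable⇒empty empty⇒unsatisfiable
  where
  unsatisfiable⇒empty : ¬ Satisfiable S → ∀ R → IsReducedBG S R → EmptyGraph S R
  unsatisfiable⇒empty unsat R reduced n Rn =
    reduced-nonempty⇒¬¬fulfilling-run S reduced Rn λ (ν , run , fulfilling) →
    unsat (fulfilling-run⇒satisfiable S run fulfilling)

  empty⇒unsatisfiable : (∀ R → IsReducedBG S R → EmptyGraph S R) → ¬ Satisfiable S
  empty⇒unsatisfiable empty sat =
    let ν , run , fulfilling = satisfiable⇒fulfilling-run S sat in
    fulfilling-run⇒¬¬reduced-nonempty S run fulfilling λ (R , reduced , n , Rn) → empty R reduced n Rn
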